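{- In each of the logics DmBL and DmBL$_\ast$, for all $\phi,\psi\in\mathcal{L}$: $\vdash(\psi|\phi)\times\phi$.
   Context: Fix a set $\Theta$ of atomic propositions. The language $\mathcal{L}$ is the smallest set containing $\Theta$ and closed under the formation of $\neg\phi$, $\Box\phi$, $\phi\rightarrow\psi$ and the conditional $(\psi|\phi)$. Abbreviations: $\phi\vee\psi=\neg\phi\rightarrow\psi$, $\phi\wedge\psi=\neg(\neg\phi\vee\neg\psi)$, $\phi\leftrightarrow\psi=(\phi\rightarrow\psi)\wedge(\psi\rightarrow\phi)$, $\top=\theta_0\rightarrow\theta_0$ for a fixed $\theta_0\in\Theta$, $\bot=\neg\top$, $\Diamond\phi=\neg\Box\neg\phi$, and (logical independence) $\psi\times\phi=\Box\bigl((\psi|\phi)\leftrightarrow\psi\bigr)$. The theorems ($\vdash$) of DmBL are the smallest set containing all instances of the axiom schemes below and closed under modus ponens (from $\vdash\phi$ and $\vdash\phi\rightarrow\psi$ infer $\vdash\psi$) and necessitation m1 (from $\vdash\phi$ infer $\vdash\Box\phi$): c1 $\phi\rightarrow(\psi\rightarrow\phi)$; c2 $(\eta\rightarrow(\phi\rightarrow\psi))\rightarrow((\eta\rightarrow\phi)\rightarrow(\eta\rightarrow\psi))$; c3 $(\neg\phi\rightarrow\neg\psi)\rightarrow((\neg\phi\rightarrow\psi)\rightarrow\phi)$; m2 $\Box(\phi\rightarrow\psi)\rightarrow(\Box\phi\rightarrow\Box\psi)$; m3 $\Box\phi\rightarrow\phi$; b1 $\Box(\phi\rightarrow\psi)\rightarrow(\Box\neg\phi\vee\Box(\psi|\phi))$;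 b2 $((\psi\rightarrow\eta)|\phi)\rightarrow((\psi|\phi)\rightarrow(\eta|\phi))$; b3 $(\psi|\phi)\rightarrow(\phi\rightarrow\psi)$; b4 $\neg(\neg\psi|\phi)\leftrightarrow(\psi|\phi)$; b5 $(\psi\times\phi)\leftrightarrow(\phi\times\psi)$. The logic DmBL$_\ast$ is defined in the same way but with b5 replaced by the two schemes b5.weak.A $(\psi\times\neg\phi)\leftrightarrow(\psi\times\phi)$ and b5.weak.B $\Box(\psi\leftrightarrow\eta)\rightarrow\Box((\phi|\psi)\leftrightarrow(\phi|\eta))$. -}

module Defs where

-- The language L over a set Θ of atomic propositions, with a fixed θ₀ ∈ Θ
-- (used only to define ⊤ = θ₀ → θ₀).

module Language (Θ : Set) (θ₀ : Θ) where

  infixr 5 _⇒_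

  data Form : Set where
    atom  : Θ → Form
    ¬'_   : Form → Form
    □_    : Form → Form
    _⇒_   : Form → Form → Form
    -- cond ψ φ  is the conditional (ψ | φ)
    cond  : Form → Form → Form

  _∨'_ : Form → Form → Form
  φ ∨' ψ = (¬' φ) ⇒ ψ

  _∧'_ : Form → Form → Form
  φ ∧' ψ = ¬' ((¬' φ) ∨' (¬' ψ))

  _⇔_ : Form → Form → Form
  φ ⇔ ψ = (φ ⇒ ψ) ∧' (ψ ⇒ φ)

  ⊤' : Form
  ⊤' = atom θ₀ ⇒ atom θ₀

  ⊥' : Form
  ⊥' = ¬' ⊤'

  ◇_ : Form → Form
  ◇ φ = ¬' (□ (¬' φ))

  -- logical independence  ψ × φ = □((ψ|φ) ↔ ψ)
  indep : Form → Form → Form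
  indep ψ φ = □ (cond ψ φ ⇔ ψ)

  data Logic : Set where
    DmBL DmBL* : Logic

  data Axiom : Logic → Form → Set where
    c1 : ∀ {L} φ ψ → Axiom L (φ ⇒ (ψ ⇒ φ))
    c2 : ∀ {L} η φ ψ → Axiom L ((η ⇒ (φ ⇒ ψ)) ⇒ ((η ⇒ φ) ⇒ (η ⇒ ψ)))
    c3 : ∀ {L} φ ψ → Axiom L (((¬' φ) ⇒ (¬' ψ)) ⇒ (((¬' φ) ⇒ ψ) ⇒ φ))
    m2 : ∀ {L} φ ψ → Axiom L ((□ (φ ⇒ ψ)) ⇒ ((□ φ) ⇒ (□ ψ)))
    m3 : ∀ {L} φ → Axiom L ((□ φ) ⇒ φ)
    b1 : ∀ {L} φ ψ → Axiom L ((□ (φ ⇒ ψ)) ⇒ ((□ (¬' φ)) ∨' (□ (cond ψ φ))))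
    b2 : ∀ {L} φ ψ η → Axiom L (cond (ψ ⇒ η) φ ⇒ (cond ψ φ ⇒ cond η φ))
    b3 : ∀ {L} φ ψ → Axiom L (cond ψ φ ⇒ (φ ⇒ ψ))
    b4 : ∀ {L} φ ψ → Axiom L ((¬' (cond (¬' ψ) φ)) ⇔ cond ψ φ)
    b5 : ∀ φ ψ → Axiom DmBL (indep ψ φ ⇔ indep φ ψ)
    b5wA : ∀ φ ψ → Axiom DmBL* (indep ψ (¬' φ) ⇔ indep ψ φ)
    b5wB : ∀ φ ψ η → Axiom DmBL* ((□ (ψ ⇔ η)) ⇒ (□ (cond φ ψ ⇔ cond φ η)))

  data ⊢[_]_ : Logic → Form → Set where
    ax  : ∀ {L φ} → Axiom L φ → ⊢[ L ] φ
    mp  : ∀ {L φ ψ} → ⊢[ L ] φ → ⊢[ L ] (φ ⇒ ψ) → ⊢[ L ] ψ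
    nec : ∀ {L φ} → ⊢[ L ] φ → ⊢[ L ] (□ φ)

{-# OPTIONS --safe #-}
module Submission where

-- Split on whether φ is possible.  If ◇φ, axiom b1 turns the theorems
-- φ → ((ψ|φ) → ψ) and φ → (¬(ψ|φ) → ¬ψ) (from b3 and b4) into
-- □(((ψ|φ) → ψ) | φ) and □((¬(ψ|φ) → ¬ψ) | φ), and b2 (with b4 for the
-- second) yields both directions of □(((ψ|φ)|φ) ↔ (ψ|φ)).  If □¬φ, every
-- formula is independent of the necessary formula ¬φ, and independence of ¬φ
-- transfers to φ: in DmBL* this is b5.weak.A; in DmBL it follows from the
-- symmetry b5, because by b4 independence is invariant under negating its
-- first argument.

open import Defs
open import Data.List using (List; []; _∷_; [_])
open import Data.List.Membership.Propositional using (_∈_)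
open import Data.List.Relation.Unary.Any using (here; there)
open import Relation.Binary.PropositionalEquality using (refl)

module _ (Θ : Set) (θ₀ : Θ) where
  open Language Θ θ₀

  module Hilbert (L : Logic) where

    infix  3 _⊢_
    infixl 6 _·_
    infixr 5 ƛ_

    data _⊢_ (Γ : List Form) : Form → Set where
      hyp : ∀ {A} → A ∈ Γ → Γ ⊢ A
      thm : ∀ {A} → ⊢[ L ] A → Γ ⊢ A
      _·_ : ∀ {A B} → Γ ⊢ A ⇒ B → Γ ⊢ A → Γ ⊢ B

    axm : ∀ {Γ A} → Axiom L A → Γ ⊢ A
    axm a = thm (ax a)

    #0 : ∀ {Γ A} → A ∷ Γ ⊢ A
    #0 = hyp (here refl)

    #1 : ∀ {Γ A B} → B ∷ A ∷ Γ ⊢ A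
    #1 = hyp (there (here refl))

    #2 : ∀ {Γ A B C} → C ∷ B ∷ A ∷ Γ ⊢ A
    #2 = hyp (there (there (here refl)))

    weaken : ∀ {Γ A B} → Γ ⊢ A → B ∷ Γ ⊢ A
    weaken (hyp x) = hyp (there x)
    weaken (thm t) = thm t
    weaken (p · q) = weaken p · weaken q

    ⇒-refl : ∀ {A} → ⊢[ L ] (A ⇒ A)
    ⇒-refl {A} = mp (ax (c1 A A)) (mp (ax (c1 A (A ⇒ A))) (ax (c2 A (A ⇒ A) A)))

    ƛ_ : ∀ {Γ A B} → A ∷ Γ ⊢ B → Γ ⊢ A ⇒ B
    ƛ hyp (here refl) = thm ⇒-refl
    ƛ hyp (there x)   = axm (c1 _ _) · hyp x
    ƛ thm t           = axm (c1 _ _) · thm t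
    ƛ_ {A = A} (p · q) = axm (c2 A _ _) · (ƛ p) · (ƛ q)

    closed : ∀ {A} → [] ⊢ A → ⊢[ L ] A
    closed (thm t) = t
    closed (p · q) = mp (closed q) (closed p)

    raa : ∀ {Γ A B} → ¬' A ∷ Γ ⊢ B → ¬' A ∷ Γ ⊢ ¬' B → Γ ⊢ A
    raa {A = A} {B} p q = axm (c3 A B) · (ƛ q) · (ƛ p)

    contradiction : ∀ {Γ A B} → Γ ⊢ A → Γ ⊢ ¬' A → Γ ⊢ B
    contradiction p q = raa (weaken p) (weaken q)

    ¬¬-elim : ∀ {Γ A} → Γ ⊢ ¬' ¬' A → Γ ⊢ A
    ¬¬-elim p = raa #0 (weaken p)

    ¬-intro : ∀ {Γ A B} → A ∷ Γ ⊢ B → A ∷ Γ ⊢ ¬' B → Γ ⊢ ¬' A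
    ¬-intro p q = raa (weaken (ƛ p) · ¬¬-elim #0) (weaken (ƛ q) · ¬¬-elim #0)

    ¬¬-intro : ∀ {Γ A} → Γ ⊢ A → Γ ⊢ ¬' ¬' A
    ¬¬-intro p = ¬-intro (weaken p) #0

    by-cases : ∀ {Γ A B} → ¬' A ∷ Γ ⊢ B → A ∷ Γ ⊢ B → Γ ⊢ B
    by-cases p q = raa (weaken (ƛ q) · raa (weaken (weaken (ƛ p)) · #0) #1) #0

    ∧-intro : ∀ {Γ A B} → Γ ⊢ A → Γ ⊢ B → Γ ⊢ A ∧' B
    ∧-intro p q = ¬-intro (weaken q) (#0 · ¬¬-intro (weaken p))

    ∧-elimˡ : ∀ {Γ A B} → Γ ⊢ A ∧' B → Γ ⊢ A
    ∧-elimˡ p = raa (ƛ contradiction #1 #0) (weaken p)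

    ∧-elimʳ : ∀ {Γ A B} → Γ ⊢ A ∧' B → Γ ⊢ B
    ∧-elimʳ p = raa (ƛ #1) (weaken p)

    □-map : ∀ {Γ A B} → [ A ] ⊢ B → Γ ⊢ □ A → Γ ⊢ □ B
    □-map p q = axm (m2 _ _) · thm (nec (closed (ƛ p))) · q

    □-map₂ : ∀ {Γ A B C} → B ∷ [ A ] ⊢ C → Γ ⊢ □ A → Γ ⊢ □ B → Γ ⊢ □ C
    □-map₂ p q r = axm (m2 _ _) · □-map (ƛ p) q · r

    ◇⇒□cond : ∀ {Γ φ ψ} → ⊢[ L ] (φ ⇒ ψ) → Γ ⊢ ◇ φ → Γ ⊢ □ (cond ψ φ)
    ◇⇒□cond {φ = φ} {ψ} t p = axm (b1 φ ψ) · thm (nec t) · p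

    cond¬⇒¬cond : ∀ {Γ φ ψ} → Γ ⊢ cond (¬' ψ) φ → Γ ⊢ ¬' cond ψ φ
    cond¬⇒¬cond {φ = φ} {ψ} p = ¬-intro (weaken p) (∧-elimʳ (axm (b4 φ ψ)) · #0)

    ¬cond⇒cond¬ : ∀ {Γ φ ψ} → Γ ⊢ ¬' cond ψ φ → Γ ⊢ cond (¬' ψ) φ
    ¬cond⇒cond¬ {φ = φ} {ψ} p = raa (∧-elimˡ (axm (b4 φ ψ)) · #0) (weaken p)

    cond-contra : ∀ {Γ φ A B} → Γ ⊢ cond (¬' A ⇒ ¬' B) φ → Γ ⊢ cond B φ → Γ ⊢ cond A φ
    cond-contra {φ = φ} {A} {B} p q =
      raa (weaken q) (cond¬⇒¬cond (axm (b2 φ (¬' A) (¬' B)) · weaken p · ¬cond⇒cond¬ #0))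

    antecedent⇒cond⇔ : ∀ φ ψ → ⊢[ L ] (φ ⇒ (cond ψ φ ⇔ ψ))
    antecedent⇒cond⇔ φ ψ = closed (ƛ ∧-intro
      (ƛ axm (b3 φ ψ) · #0 · #1)
      (ƛ raa #1 (axm (b3 φ (¬' ψ)) · ¬cond⇒cond¬ #0 · #2)))

    □⇒indep : ∀ {Γ} a ρ → Γ ⊢ □ ρ → Γ ⊢ indep a ρ
    □⇒indep a ρ = □-map (thm (antecedent⇒cond⇔ ρ a) · #0)

    indep-¬ˡ : ∀ {Γ a ρ} → Γ ⊢ indep (¬' ρ) a → Γ ⊢ indep ρ a
    indep-¬ˡ = □-map (∧-intro
      (ƛ raa #1 (cond¬⇒¬cond (∧-elimʳ #2 · #0)))
      (ƛ raa #1 (∧-elimˡ #2 · ¬cond⇒cond¬ #0)))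

    ◇⇒cond-indep : ∀ {Γ} φ ψ → Γ ⊢ ◇ φ → Γ ⊢ indep (cond ψ φ) φ
    ◇⇒cond-indep φ ψ ◇φ = □-map₂ (∧-intro #1 #0)
        (□-map (axm (b2 φ χ ψ) · #0) (◇⇒□cond χ⇒ψ ◇φ))
        (□-map (ƛ cond-contra #1 #0) (◇⇒□cond ¬χ⇒¬ψ ◇φ))
      where
      χ : Form
      χ = cond ψ φ

      χ⇒ψ : ⊢[ L ] (φ ⇒ χ ⇒ ψ)
      χ⇒ψ = closed (ƛ ∧-elimˡ (thm (antecedent⇒cond⇔ φ ψ) · #0))

      ¬χ⇒¬ψ : ⊢[ L ] (φ ⇒ ¬' χ ⇒ ¬' ψ)
      ¬χ⇒¬ψ = closed (ƛ ƛ ¬-intro (∧-elimʳ (thm (antecedent⇒cond⇔ φ ψ) · #2) · #0) #1)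

  indep-¬ʳ : ∀ L a ρ → ⊢[ L ] (indep a (¬' ρ) ⇒ indep a ρ)
  indep-¬ʳ DmBL a ρ = closed (ƛ indep-sym (indep-¬ˡ (indep-sym #0)))
    where
    open Hilbert DmBL

    indep-sym : ∀ {Γ a b} → Γ ⊢ indep a b → Γ ⊢ indep b a
    indep-sym {a = a} {b} p = ∧-elimˡ (axm (b5 b a)) · p
  indep-¬ʳ DmBL* a ρ = closed (ƛ ∧-elimˡ (axm (b5wA ρ a)) · #0)
    where open Hilbert DmBL*

mainTheorem7 : (Θ : Set) (θ₀ : Θ) → let open Language Θ θ₀ in
    (L : Logic) (φ ψ : Form) → ⊢[ L ] indep (cond ψ φ) φ
mainTheorem7 Θ θ₀ L φ ψ = closed (by-cases
    (◇⇒cond-indep φ ψ #0)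
    (thm (indep-¬ʳ Θ θ₀ L χ φ) · □⇒indep χ (¬' φ) #0))
  where
  open Language Θ θ₀
  open Hilbert Θ θ₀ L

  χ : Form
  χ = cond ψ φ
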